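{- Let $\mu=(\mathrm{Val},(\mathcal P,\mathcal O),\varsigma)$ be a model with $\mathrm{Val}=\{0,0.5,1\}$ for the predicate symbols $\mathrm{input},\mathrm{echo}_1,\mathrm{echo}_2,\mathrm{output}$, whose semitopology is 3-twined, and suppose every axiom of $\mathrm{ThyCA}$ is valid in $\mu$. Then for every $v\in\{0,0.5,1\}$, $$\models\mathrm{echo}_2(v)\to_s\mathsf{Quorum}\,\mathrm{echo}_1(v).$$
   Context: Truth values: $\mathbf 3=\{\mathbf f,\mathbf b,\mathbf t\}$ totally ordered by $\mathbf f<\mathbf b<\mathbf t$; $\wedge,\vee$ are min and max, $\bigwedge,\bigvee$ are infimum and supremum. Negation: $\neg\mathbf t=\mathbf f$, $\neg\mathbf b=\mathbf b$, $\neg\mathbf f=\mathbf t$. Modalities: $\mathsf T x=\mathbf t$ if $x=\mathbf t$, else $\mathbf f$; $\mathsf B x=\mathbf t$ if $x=\mathbf b$, else $\mathbf f$; $\mathsf{TF}x=\mathbf t$ if $x\in\{\mathbf t,\mathbf f\}$, else $\mathbf f$. Weak implication $x\to_w y:=\neg x\vee y$; strong implication $x\to_s y:=\neg x\vee\mathsf T y$. Exclusive-or: $x\oplus y=\mathbf b$ if $x=\mathbf b$ or $y=\mathbf b$; otherwise $\mathbf t$ if $x\neq y$ and $\mathbf f$ if $x=y$. A truth value is valid iff it lies in $\{\mathbf t,\mathbf b\}$. A semitopology $(\mathcal P,\mathcal O)$ is a set $\mathcal P$ with a family $\mathcal O$ of subsets containing $\mathcal P$ and closed under arbitrary (including empty)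 unions; $\mathcal O^{\neq\emptyset}$ is the set of nonempty members. It is 3-twined if any three members of $\mathcal O^{\neq\emptyset}$ have nonempty intersection. For $f:\mathcal P\to\mathbf 3$: $\mathsf{Everywhere} f=\bigwedge_{p}f(p)$, $\mathsf{Somewhere} f=\bigvee_p f(p)$, $\mathsf{Quorum} f=\bigvee_{O\in\mathcal O^{\neq\emptyset}}\bigwedge_{p\in O}f(p)$, $\mathsf{Contraquorum} f=\bigwedge_{O\in\mathcal O^{\neq\emptyset}}\bigvee_{p\in O}f(p)$. Logic: a model $\mu=(\mathrm{Val},(\mathcal P,\mathcal O),\varsigma)$ consists of a nonempty set $\mathrm{Val}$, a semitopology, and for each predicate symbol $R$ a function $\varsigma(R):\mathcal P\to\mathrm{Val}\to\mathbf 3$. Formulas are built from atoms $R(t)$, value equalities $v\doteq v'$ (denoting $\mathbf t$ if $v=v'$, else $\mathbf f$), connectives $\neg,\wedge,\vee,\to_w,\to_s,\oplus$, modalities $\mathsf T,\mathsf B,\mathsf{TF}$, operators $\mathsf{Everywhere},\mathsf{Somewhere},\mathsf{Quorum},\mathsf{Contraquorum}$ and quantifiers over $\mathrm{Val}$. Denotation $[\![\phi]\!]:\mathcal P\to\mathbf 3$: $[\![R(v)]\!](p)=\varsigma(R)(p)(v)$; connectives and modalities act pointwise in $p$; $[\![\mathsf{Quorum}\,\phi]\!](p)=\mathsf{Quorum}([\![\phi]\!])$ for all $p$, likewise for the other three operators; $[\![\exists a.\phi]\!](p)=\bigvee_{v}[\![\phi[a:=v]]\!](p)$, $[\![\forall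 a.\phi]\!](p)=\bigwedge_{v}[\![\phi[a:=v]]\!](p)$; $[\![\exists_{01}a.\phi]\!](p)=\bigwedge_{v,v'}\big(([\![\phi[a:=v]]\!](p)\wedge[\![\phi[a:=v']]\!](p))\to_w (v\doteq v')\big)$. $p\models\phi$ iff $[\![\phi]\!](p)\in\{\mathbf t,\mathbf b\}$; $\models\phi$ iff $p\models\phi$ for all $p$. $\mathrm{correct}(R):=\forall a.\mathsf{TF}R(a)$, $\mathrm{incorrect}(R):=\forall a.\mathsf B R(a)$, $\mathrm{correct}(R_1,\dots,R_n):=\bigwedge_i\mathrm{correct}(R_i)$. Axioms with a free variable $a$ are universally quantified over $a$; an axiom is valid in $\mu$ if $\models$ it. $\mathrm{ThyCA}$ (with $\mathrm{Val}=\{0,0.5,1\}$) consists of: CaEcho1?: $\mathrm{echo}_1(a)\to_s\mathsf{Somewhere}\,\mathrm{input}(a)$; CaEcho2?: $\mathrm{echo}_2(a)\to_w\mathsf{Quorum}\,\mathrm{echo}_1(a)$; CaOutput?: $(\mathrm{output}(0)\to_w\mathsf{Quorum}\,\mathrm{echo}_2(0))\wedge(\mathrm{output}(1)\to_w\mathsf{Quorum}\,\mathrm{echo}_2(1))$; CaOutput'?: $\mathrm{output}(0.5)\to_w(\mathsf{Quorum}\,\mathrm{echo}_1(0)\wedge\mathsf{Quorum}\,\mathrm{echo}_1(1))$; CaCorrect: $\mathsf{Quorum}\,\mathrm{correct}(\mathrm{input},\mathrm{echo}_1,\mathrm{echo}_2,\mathrm{output})$; CaCorrect': $\mathrm{correct}(R)\vee\mathrm{incorrect}(R)$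 for each $R\in\{\mathrm{input},\mathrm{echo}_1,\mathrm{echo}_2,\mathrm{output}\}$; CaInput: $(\mathrm{input}(0)\oplus\mathrm{input}(1))\wedge\neg\mathrm{input}(0.5)$; CaEcho2$_{01}$: $\exists_{01}a.\mathrm{echo}_2(a)$; CaEcho1!: $(\mathrm{input}(a)\vee\mathsf{Contraquorum}\,\mathrm{echo}_1(a))\to_w\mathrm{echo}_1(a)$; CaEcho2!: $(\exists a.\mathsf{Quorum}\,\mathrm{echo}_1(a))\to_w\exists a.\mathrm{echo}_2(a)$; CaOutput!: $\mathsf{Quorum}\,\mathrm{echo}_2(a)\to_w\mathrm{output}(a)$; CaOutput'!: $(\mathsf{Quorum}\,\mathrm{echo}_1(0)\wedge\mathsf{Quorum}\,\mathrm{echo}_1(1))\to_w\mathrm{output}(0.5)$. -}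

module Defs where

open import Level using (Level; Lift; lift; 0ℓ) renaming (suc to lsuc)
open import Data.Product using (Σ; Σ-syntax; _×_; _,_; proj₁)
open import Data.Unit using (⊤)
open import Data.Empty using (⊥)
open import Relation.Nullary using (Dec; yes; no; ¬_)
open import Relation.Binary.PropositionalEquality using (_≡_)
open import Axiom.ExcludedMiddle using (ExcludedMiddle)

data Three : Set where
  𝐟 𝐛 𝐭 : Three

_∧₃_ : Three → Three → Three
𝐟 ∧₃ y = 𝐟
𝐛 ∧₃ 𝐟 = 𝐟
𝐛 ∧₃ y = 𝐛
𝐭 ∧₃ y = y

_∨₃_ : Three → Three → Three
𝐭 ∨₃ y = 𝐭
𝐛 ∨₃ 𝐭 = 𝐭
𝐛 ∨₃ y = 𝐛
𝐟 ∨₃ y = y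

¬₃ : Three → Three
¬₃ 𝐭 = 𝐟
¬₃ 𝐛 = 𝐛
¬₃ 𝐟 = 𝐭

T₃ : Three → Three
T₃ 𝐭 = 𝐭
T₃ _ = 𝐟

B₃ : Three → Three
B₃ 𝐛 = 𝐭
B₃ _ = 𝐟

TF₃ : Three → Three
TF₃ 𝐛 = 𝐟
TF₃ _ = 𝐭

_→w_ : Three → Three → Three
x →w y = ¬₃ x ∨₃ y

_→s_ : Three → Three → Three
x →s y = ¬₃ x ∨₃ T₃ y

_⊕₃_ : Three → Three → Three
𝐛 ⊕₃ y = 𝐛
x ⊕₃ 𝐛 = 𝐛
𝐭 ⊕₃ 𝐭 = 𝐟
𝐭 ⊕₃ 𝐟 = 𝐭
𝐟 ⊕₃ 𝐭 = 𝐭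
𝐟 ⊕₃ 𝐟 = 𝐟

Valid : Three → Set
Valid 𝐭 = ⊤
Valid 𝐛 = ⊤
Valid 𝐟 = ⊥

-- Arbitrary suprema / infima in the total order 3.
-- The metatheory of the paper is classical; suprema over arbitrary
-- families are computed using an excluded-middle oracle.

EM : Set₂
EM = ExcludedMiddle (lsuc 0ℓ)

⋁ : EM → (I : Set₁) → (I → Three) → Three
⋁ em I g with em {Σ I λ i → g i ≡ 𝐭}
... | yes _ = 𝐭
... | no _ with em {Σ I λ i → g i ≡ 𝐛}
...   | yes _ = 𝐛
...   | no _ = 𝐟

⋀ : EM → (I : Set₁) → (I → Three) → Three
⋀ em I g with em {Σ I λ i → g i ≡ 𝐟}
... | yes _ = 𝐟
... | no _ with em {Σ I λ i → g i ≡ 𝐛}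
...   | yes _ = 𝐛
...   | no _ = 𝐭

record Semitopology : Set₂ where
  field
    Pt    : Set
    Open  : (Pt → Set) → Set₁
    full  : Open (λ _ → ⊤)
    union : (J : Set) (U : J → Pt → Set) → (∀ j → Open (U j)) →
            Open (λ p → Σ J λ j → U j p)

module _ (S : Semitopology) where
  open Semitopology S

  Nonempty : (Pt → Set) → Set
  Nonempty O = Σ Pt O

  Open≠∅ : Set₁
  Open≠∅ = Σ (Pt → Set) λ O → Open O × Nonempty O

  ThreeTwined : Set₁
  ThreeTwined = (O₁ O₂ O₃ : Open≠∅) →
    Σ Pt λ p → proj₁ O₁ p × proj₁ O₂ p × proj₁ O₃ p

module _ (em : EM) (S : Semitopology) where
  open Semitopology S

  Everywhere : (Pt → Three) → Three
  Everywhere f = ⋀ em (Lift (lsuc 0ℓ) Pt) λ { (lift p) → f p }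

  Somewhere : (Pt → Three) → Three
  Somewhere f = ⋁ em (Lift (lsuc 0ℓ) Pt) λ { (lift p) → f p }

  Quorum : (Pt → Three) → Three
  Quorum f = ⋁ em (Open≠∅ S) λ O →
    ⋀ em (Lift (lsuc 0ℓ) (Σ Pt (proj₁ O))) λ { (lift (p , _)) → f p }

  Contraquorum : (Pt → Three) → Three
  Contraquorum f = ⋀ em (Open≠∅ S) λ O →
    ⋁ em (Lift (lsuc 0ℓ) (Σ Pt (proj₁ O))) λ { (lift (p , _)) → f p }

data Val : Set where
  v0 v½ v1 : Val

_≐_ : Val → Val → Three
v0 ≐ v0 = 𝐭
v½ ≐ v½ = 𝐭
v1 ≐ v1 = 𝐭
_  ≐ _  = 𝐟

∀V : (Val → Three) → Three
∀V φ = φ v0 ∧₃ (φ v½ ∧₃ φ v1)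

∃V : (Val → Three) → Three
∃V φ = φ v0 ∨₃ (φ v½ ∨₃ φ v1)

∃₀₁V : (Val → Three) → Three
∃₀₁V φ = ∀V λ v → ∀V λ v' → (φ v ∧₃ φ v') →w (v ≐ v')

record Model : Set₂ where
  field
    S      : Semitopology
    input  : Semitopology.Pt S → Val → Three
    echo₁  : Semitopology.Pt S → Val → Three
    echo₂  : Semitopology.Pt S → Val → Three
    output : Semitopology.Pt S → Val → Three

correct : {P : Set} → (P → Val → Three) → P → Three
correct R p = ∀V λ a → TF₃ (R p a)

incorrect : {P : Set} → (P → Val → Three) → P → Three
incorrect R p = ∀V λ a → B₃ (R p a)

⊨ : {P : Set} → (P → Three) → Set
⊨ φ = ∀ p → Valid (φ p)

record ThyCA (em : EM) (μ : Model) : Set₁ where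
  open Model μ
  private
    P = Semitopology.Pt S
    Q = Quorum em S
    CQ = Contraquorum em S
    SW = Somewhere em S
  field
    CaEcho1? : ∀ a → ⊨ λ p → echo₁ p a →s SW (λ q → input q a)
    CaEcho2? : ∀ a → ⊨ λ p → echo₂ p a →w Q (λ q → echo₁ q a)
    CaOutput? : ⊨ λ p → (output p v0 →w Q (λ q → echo₂ q v0))
                      ∧₃ (output p v1 →w Q (λ q → echo₂ q v1))
    CaOutput'? : ⊨ λ p → output p v½ →w (Q (λ q → echo₁ q v0) ∧₃ Q (λ q → echo₁ q v1))
    CaCorrect : ⊨ λ (p : P) → Q λ q →
      correct input q ∧₃ (correct echo₁ q ∧₃ (correct echo₂ q ∧₃ correct output q))
    CaCorrect'-input  : ⊨ λ p → correct input p ∨₃ incorrect input p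
    CaCorrect'-echo₁  : ⊨ λ p → correct echo₁ p ∨₃ incorrect echo₁ p
    CaCorrect'-echo₂  : ⊨ λ p → correct echo₂ p ∨₃ incorrect echo₂ p
    CaCorrect'-output : ⊨ λ p → correct output p ∨₃ incorrect output p
    CaInput : ⊨ λ p → (input p v0 ⊕₃ input p v1) ∧₃ ¬₃ (input p v½)
    CaEcho2₀₁ : ⊨ λ p → ∃₀₁V λ a → echo₂ p a
    CaEcho1! : ∀ a → ⊨ λ p → (input p a ∨₃ CQ (λ q → echo₁ q a)) →w echo₁ p a
    CaEcho2! : ⊨ λ p → (∃V λ a → Q (λ q → echo₁ q a)) →w (∃V λ a → echo₂ p a)
    CaOutput! : ∀ a → ⊨ λ p → Q (λ q → echo₂ q a) →w output p a
    CaOutput'! : ⊨ λ p → (Q (λ q → echo₁ q v0) ∧₃ Q (λ q → echo₁ q v1)) →w output p v½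

module Submission where

-- By CaEcho2?, a valid echo₂(v) makes Quorum echo₁(v) valid: echo₁(v) is valid on
-- some nonempty open O.  CaCorrect gives a nonempty open O' of correct points, where
-- echo₁(v) is two-valued.  By 3-twinedness every nonempty open O'' meets O ∩ O', at a
-- point where echo₁(v) is valid and two-valued, hence 𝐭; so Contraquorum echo₁(v) = 𝐭,
-- and CaEcho1! makes echo₁(v) valid everywhere.  On O' it is then 𝐭, so the quorum is 𝐭.

open import Defs
open import Level using (lift)
open import Data.Product using (Σ-syntax; _×_; _,_; proj₁; proj₂)
open import Data.Unit using (tt)
open import Data.Empty using (⊥; ⊥-elim)
open import Relation.Nullary using (yes; no)
open import Relation.Binary.PropositionalEquality using (_≡_; refl; sym; cong; trans)

≡𝐭⇒Valid : ∀ {x} → x ≡ 𝐭 → Valid x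
≡𝐭⇒Valid refl = tt

≡𝐛⇒Valid : ∀ {x} → x ≡ 𝐛 → Valid x
≡𝐛⇒Valid refl = tt

𝐭≢𝐟 : 𝐭 ≡ 𝐟 → ⊥
𝐭≢𝐟 ()

𝐭≢𝐛 : 𝐭 ≡ 𝐛 → ⊥
𝐭≢𝐛 ()

Valid∧TF⇒≡𝐭 : ∀ x → Valid x → Valid (TF₃ x) → x ≡ 𝐭
Valid∧TF⇒≡𝐭 𝐭 _ _ = refl
Valid∧TF⇒≡𝐭 𝐛 _ ()
Valid∧TF⇒≡𝐭 𝐟 () _

Valid-∧₃ : ∀ x y → Valid (x ∧₃ y) → Valid x × Valid y
Valid-∧₃ 𝐭 y v = tt , v
Valid-∧₃ 𝐛 𝐭 _ = tt , tt
Valid-∧₃ 𝐛 𝐛 _ = tt , tt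
Valid-∧₃ 𝐛 𝐟 ()
Valid-∧₃ 𝐟 y ()

∨₃-zeroʳ : ∀ x → x ∨₃ 𝐭 ≡ 𝐭
∨₃-zeroʳ 𝐟 = refl
∨₃-zeroʳ 𝐛 = refl
∨₃-zeroʳ 𝐭 = refl

Valid-𝐛∨₃ : ∀ x → Valid (𝐛 ∨₃ x)
Valid-𝐛∨₃ 𝐟 = tt
Valid-𝐛∨₃ 𝐛 = tt
Valid-𝐛∨₃ 𝐭 = tt

→w-modus-ponens : ∀ {x y} → Valid (x →w y) → x ≡ 𝐭 → Valid y
→w-modus-ponens v refl = v

→w-strengthen : ∀ x y → Valid (x →w y) → (Valid y → y ≡ 𝐭) → Valid (x →s y)
→w-strengthen 𝐟 y _ _ = tt
→w-strengthen 𝐛 y _ _ = Valid-𝐛∨₃ (T₃ y)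
→w-strengthen 𝐭 y valid definite rewrite definite valid = tt

∀V-Valid : ∀ φ → Valid (∀V φ) → ∀ v → Valid (φ v)
∀V-Valid φ valid v0 = proj₁ (Valid-∧₃ (φ v0) _ valid)
∀V-Valid φ valid v½ = proj₁ (Valid-∧₃ (φ v½) (φ v1) (proj₂ (Valid-∧₃ (φ v0) _ valid)))
∀V-Valid φ valid v1 = proj₂ (Valid-∧₃ (φ v½) (φ v1) (proj₂ (Valid-∧₃ (φ v0) _ valid)))

module _ (em : EM) (I : Set₁) (g : I → Three) where

  ⋁-≡𝐭 : (i : I) → g i ≡ 𝐭 → ⋁ em I g ≡ 𝐭
  ⋁-≡𝐭 i gi≡𝐭 with em {Σ[ i ∈ I ] g i ≡ 𝐭}
  ... | yes _ = refl
  ... | no ∄i = ⊥-elim (∄i (i , gi≡𝐭))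

  ⋁-Valid : Valid (⋁ em I g) → Σ[ i ∈ I ] Valid (g i)
  ⋁-Valid valid with em {Σ[ i ∈ I ] g i ≡ 𝐭}
  ... | yes (i , gi≡𝐭) = i , ≡𝐭⇒Valid gi≡𝐭
  ... | no _ with em {Σ[ i ∈ I ] g i ≡ 𝐛}
  ...   | yes (i , gi≡𝐛) = i , ≡𝐛⇒Valid gi≡𝐛
  ...   | no _ = ⊥-elim valid

  ⋀-Valid : Valid (⋀ em I g) → (i : I) → Valid (g i)
  ⋀-Valid valid i with em {Σ[ i ∈ I ] g i ≡ 𝐟}
  ... | yes _ = ⊥-elim valid
  ... | no ∄i with g i in gi≡
  ...   | 𝐭 = tt
  ...   | 𝐛 = tt
  ...   | 𝐟 = ⊥-elim (∄i (i , gi≡))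

  ⋀-≡𝐭 : ((i : I) → g i ≡ 𝐭) → ⋀ em I g ≡ 𝐭
  ⋀-≡𝐭 all𝐭 with em {Σ[ i ∈ I ] g i ≡ 𝐟}
  ... | yes (i , gi≡𝐟) = ⊥-elim (𝐭≢𝐟 (trans (sym (all𝐭 i)) gi≡𝐟))
  ... | no _ with em {Σ[ i ∈ I ] g i ≡ 𝐛}
  ...   | yes (i , gi≡𝐛) = ⊥-elim (𝐭≢𝐛 (trans (sym (all𝐭 i)) gi≡𝐛))
  ...   | no _ = refl

module _ (em : EM) (S : Semitopology) where
  open Semitopology S

  Quorum-Valid : ∀ f → Valid (Quorum em S f) →
                 Σ[ O ∈ Open≠∅ S ] (∀ q → proj₁ O q → Valid (f q))
  Quorum-Valid f valid with ⋁-Valid em _ _ valid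
  ... | O , validInf = O , λ q q∈O → ⋀-Valid em _ _ validInf (lift (q , q∈O))

  Quorum-≡𝐭 : ∀ f (O : Open≠∅ S) → (∀ q → proj₁ O q → f q ≡ 𝐭) → Quorum em S f ≡ 𝐭
  Quorum-≡𝐭 f O all𝐭 =
    ⋁-≡𝐭 em _ _ O (⋀-≡𝐭 em _ _ λ { (lift (q , q∈O)) → all𝐭 q q∈O })

  Contraquorum-≡𝐭 : ∀ f → (∀ (O : Open≠∅ S) → Σ[ q ∈ Pt ] proj₁ O q × f q ≡ 𝐭) →
                    Contraquorum em S f ≡ 𝐭
  Contraquorum-≡𝐭 f meets𝐭 = ⋀-≡𝐭 em _ _ λ O →
    let (q , q∈O , fq≡𝐭) = meets𝐭 O in ⋁-≡𝐭 em _ _ (lift (q , q∈O)) fq≡𝐭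

  twined-Contraquorum-≡𝐭 : ThreeTwined S → ∀ f (O O′ : Open≠∅ S) →
    (∀ q → proj₁ O q → Valid (f q)) → (∀ q → proj₁ O′ q → Valid (TF₃ (f q))) →
    Contraquorum em S f ≡ 𝐭
  twined-Contraquorum-≡𝐭 twined f O O′ validOnO twoValuedOnO′ = Contraquorum-≡𝐭 f λ O″ →
    let (q , q∈O , q∈O′ , q∈O″) = twined O O′ O″
    in q , q∈O″ , Valid∧TF⇒≡𝐭 (f q) (validOnO q q∈O) (twoValuedOnO′ q q∈O′)

module _ {em : EM} {μ : Model} (twined : ThreeTwined (Model.S μ)) (thy : ThyCA em μ) where
  open Model μ
  open ThyCA thy
  open Semitopology S

  echo₁-twoValued-on-open : Pt → Σ[ O ∈ Open≠∅ S ] (∀ q → proj₁ O q → ∀ v → Valid (TF₃ (echo₁ q v)))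
  echo₁-twoValued-on-open p with Quorum-Valid em S _ (CaCorrect p)
  ... | O , correctOnO = O , λ q q∈O → ∀V-Valid (λ v → TF₃ (echo₁ q v))
    (proj₁ (Valid-∧₃ (correct echo₁ q) _ (proj₂ (Valid-∧₃ (correct input q) _ (correctOnO q q∈O)))))

  echo₁-Valid-everywhere : ∀ v → Contraquorum em S (λ q → echo₁ q v) ≡ 𝐭 → ∀ q → Valid (echo₁ q v)
  echo₁-Valid-everywhere v cq≡𝐭 q =
    →w-modus-ponens (CaEcho1! v q) (trans (cong (input q v ∨₃_) cq≡𝐭) (∨₃-zeroʳ (input q v)))

  Quorum-echo₁-Valid⇒≡𝐭 : ∀ v → Valid (Quorum em S (λ q → echo₁ q v)) →
                          Quorum em S (λ q → echo₁ q v) ≡ 𝐭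
  Quorum-echo₁-Valid⇒≡𝐭 v valid =
    let (O , validOnO) = Quorum-Valid em S _ valid
        (O′ , twoValuedOnO′) = echo₁-twoValued-on-open (proj₁ (proj₂ (proj₂ O)))
        twoValued-v = λ q q∈O′ → twoValuedOnO′ q q∈O′ v
        cq≡𝐭 = twined-Contraquorum-≡𝐭 em S twined _ O O′ validOnO twoValued-v
    in Quorum-≡𝐭 em S _ O′ λ q q∈O′ →
         Valid∧TF⇒≡𝐭 _ (echo₁-Valid-everywhere v cq≡𝐭 q) (twoValued-v q q∈O′)

corollary5p15 : (em : EM) (μ : Model) →
    ThreeTwined (Model.S μ) → ThyCA em μ →
    (v : Val) →
    ⊨ λ p → Model.echo₂ μ p v →s Quorum em (Model.S μ) (λ q → Model.echo₁ μ q v)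
corollary5p15 em μ twined thy v p =
  →w-strengthen (echo₂ p v) _ (CaEcho2? v p) (Quorum-echo₁-Valid⇒≡𝐭 twined thy v)
  where
  open Model μ
  open ThyCA thy
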